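{- In each of the two deduction systems DBL and DBL$_\ast$, for all formulas $\phi,\psi\in\mathcal{L}$ the sequent $\vdash(\psi|\phi)\times\phi$ is derivable.
   Context: Fix a finite set $\Theta$ of atomic propositions and a distinguished $\theta_1\in\Theta$. The language $\mathcal{L}$ is the smallest set containing $\Theta$ such that $\neg\phi$, $\phi\rightarrow\psi$ and $(\psi|\phi)$ belong to $\mathcal{L}$ whenever $\phi,\psi\in\mathcal{L}$. Abbreviations: $\phi\vee\psi:=\neg\phi\rightarrow\psi$, $\phi\wedge\psi:=\neg(\neg\phi\vee\neg\psi)$, $\phi\leftrightarrow\psi:=(\phi\rightarrow\psi)\wedge(\psi\rightarrow\phi)$, $\psi\times\phi:=(\psi|\phi)\leftrightarrow\psi$, $\top:=\theta_1\rightarrow\theta_1$, $\bot:=\neg\top$. A sequent is a pair of finite (possibly empty) sequences $\Gamma,\Delta$ of formulas of $\mathcal{L}$, written $\Gamma\vdash\Delta$; "$\Gamma,\Delta$" denotes concatenation and $\{\Gamma\}$ the set of entries of $\Gamma$. The systems DBL and DBL$_\ast$ are the smallest sets of sequents $X$ satisfying, for all $\phi,\psi,\eta\in\mathcal{L}$ and finite sequences $\Gamma,\Delta,\Lambda,\Sigma$: (CUT) if $\Gamma\vdash\Delta,\phi$ and $\Lambda,\phi\vdash\Sigma$ are in $X$ then $\Gamma,\Lambda\vdash\Delta,\Sigma$ is in $X$; (STRUCT) if $\{\Gamma\}\subset\{\Lambda\}\cup\{\top\}$, $\{\Delta\}\subset\{\Sigma\}\cup\{\bot\}$ and $\Gamma\vdash\Delta$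 is in $X$ then $\Lambda\vdash\Sigma$ is in $X$; (modus ponens) $\phi,\phi\rightarrow\psi\vdash\psi$; (c1) $\vdash\phi\rightarrow(\psi\rightarrow\phi)$; (c2) $\vdash(\eta\rightarrow(\phi\rightarrow\psi))\rightarrow((\eta\rightarrow\phi)\rightarrow(\eta\rightarrow\psi))$; (c3) $\vdash(\neg\phi\rightarrow\neg\psi)\rightarrow((\neg\phi\rightarrow\psi)\rightarrow\phi)$; (b1) $\phi\rightarrow\psi\vdash\neg\phi,(\psi|\phi)$; (b2) $\vdash(\psi\rightarrow\eta|\phi)\rightarrow((\psi|\phi)\rightarrow(\eta|\phi))$; (b3) $\vdash(\psi|\phi)\rightarrow(\phi\rightarrow\psi)$; (b4) $\vdash\neg(\neg\psi|\phi)\leftrightarrow(\psi|\phi)$. DBL additionally contains (b5) $\psi\times\phi\vdash\phi\times\psi$. DBL$_\ast$ instead additionally contains (b5.weak.A) $\psi\times\neg\phi\vdash\psi\times\phi$ and $\psi\times\phi\vdash\psi\times\neg\phi$, and (b5.weak.B) $\psi\leftrightarrow\eta\vdash(\phi|\psi)\leftrightarrow(\phi|\eta)$. A sequent is derivable if it belongs to the system. -}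

module Defs where

open import Data.Nat using (ℕ; suc)
open import Data.Fin using (Fin; zero)
open import Data.Product using (_×_; _,_)
open import Data.Sum using (_⊎_)
open import Data.List using (List; []; _∷_; _++_; [_])
open import Data.List.Membership.Propositional using (_∈_)
open import Relation.Binary.PropositionalEquality using (_≡_)

-- The finite set Θ of atomic propositions is Fin (suc n) (nonempty, as it
-- contains θ₁); the distinguished atom θ₁ is  zero.
module Language (n : ℕ) where

  Atom : Set
  Atom = Fin (suc n)

  θ₁ : Atom
  θ₁ = zero

  infixr 5 _⇒_
  data Form : Set where
    atom : Atom → Form
    ¬'_  : Form → Form
    _⇒_  : Form → Form → Form
    -- cond ψ φ  is  (ψ|φ)
    cond : Form → Form → Form

  _∨'_ : Form → Form → Form
  φ ∨' ψ = (¬' φ) ⇒ ψ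

  _∧'_ : Form → Form → Form
  φ ∧' ψ = ¬' ((¬' φ) ∨' (¬' ψ))

  _⇔_ : Form → Form → Form
  φ ⇔ ψ = (φ ⇒ ψ) ∧' (ψ ⇒ φ)

  _×'_ : Form → Form → Form
  ψ ×' φ = cond ψ φ ⇔ ψ

  ⊤' : Form
  ⊤' = atom θ₁ ⇒ atom θ₁

  ⊥' : Form
  ⊥' = ¬' ⊤'

  _⊆∪_ : List Form → List Form × Form → Set
  Γ ⊆∪ (Λ , e) = ∀ {χ} → χ ∈ Γ → (χ ∈ Λ) ⊎ (χ ≡ e)

  data System : Set where
    DBL DBL* : System

  data Derivable (S : System) : List Form → List Form → Set where
    cut : ∀ {Γ Δ Λ Σ φ} →
          Derivable S Γ (Δ ++ [ φ ]) → Derivable S (Λ ++ [ φ ]) Σ →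
          Derivable S (Γ ++ Λ) (Δ ++ Σ)
    struct : ∀ {Γ Δ Λ Σ} →
          Γ ⊆∪ (Λ , ⊤') → Δ ⊆∪ (Σ , ⊥') →
          Derivable S Γ Δ → Derivable S Λ Σ
    mp : ∀ {φ ψ} → Derivable S (φ ∷ (φ ⇒ ψ) ∷ []) [ ψ ]
    c1 : ∀ {φ ψ} → Derivable S [] [ φ ⇒ (ψ ⇒ φ) ]
    c2 : ∀ {η φ ψ} →
         Derivable S [] [ (η ⇒ (φ ⇒ ψ)) ⇒ ((η ⇒ φ) ⇒ (η ⇒ ψ)) ]
    c3 : ∀ {φ ψ} →
         Derivable S [] [ ((¬' φ) ⇒ (¬' ψ)) ⇒ (((¬' φ) ⇒ ψ) ⇒ φ) ]
    b1 : ∀ {φ ψ} → Derivable S [ φ ⇒ ψ ] ((¬' φ) ∷ cond ψ φ ∷ [])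
    b2 : ∀ {φ ψ η} →
         Derivable S [] [ cond (ψ ⇒ η) φ ⇒ (cond ψ φ ⇒ cond η φ) ]
    b3 : ∀ {φ ψ} → Derivable S [] [ cond ψ φ ⇒ (φ ⇒ ψ) ]
    b4 : ∀ {φ ψ} → Derivable S [] [ (¬' (cond (¬' ψ) φ)) ⇔ cond ψ φ ]
    b5 : ∀ {φ ψ} → S ≡ DBL → Derivable S [ ψ ×' φ ] [ φ ×' ψ ]
    b5wA₁ : ∀ {φ ψ} → S ≡ DBL* → Derivable S [ ψ ×' (¬' φ) ] [ ψ ×' φ ]
    b5wA₂ : ∀ {φ ψ} → S ≡ DBL* → Derivable S [ ψ ×' φ ] [ ψ ×' (¬' φ) ]
    b5wB : ∀ {φ ψ η} → S ≡ DBL* →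
           Derivable S [ ψ ⇔ η ] [ cond φ ψ ⇔ cond φ η ]

{-# OPTIONS --safe #-}
module Submission where

-- By (b1), a theorem φ → A splits every derivation into the case ¬φ and the
-- case (A|φ).  When φ holds, (b3) and (b4) give (X|φ) ↔ X; when ¬φ holds, the
-- same argument gives X × ¬φ, which the symmetry axioms move to X × φ (b5
-- twice, around ¬φ × X ⊢ φ × X, in DBL; b5.weak.A in DBL*).  The case split
-- then yields necessitation, so by (b2) the conditional (·|φ) respects proved
-- equivalences.  Splitting on A = ((ψ|φ) ↔ ψ), the case (A|φ) gives
-- ((ψ|φ)|φ) ↔ (ψ|φ), which is the claim, and the case ¬φ gives it directly.

open import Defs
open import Data.Nat using (ℕ)
open import Data.List using (List; []; _∷_; _++_; [_])
open import Data.List.Membership.Propositional using (_∈_)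
open import Data.List.Relation.Binary.Subset.Propositional using (_⊆_)
open import Data.List.Relation.Binary.Subset.Propositional.Properties
  using (⊆-refl; ⊆-reflexive-↭; ∈-∷⁺ʳ)
open import Data.List.Relation.Binary.Permutation.Propositional using (↭-swap; ↭-refl)
open import Data.List.Relation.Unary.Any using (here; there)
open import Data.Product using (_,_)
open import Data.Sum using (inj₁)
open import Relation.Binary.PropositionalEquality using (refl)

module _ {n : ℕ} where
  open Language n

  ⊆⇒⊆∪ : ∀ {Γ Λ e} → Γ ⊆ Λ → Γ ⊆∪ (Λ , e)
  ⊆⇒⊆∪ Γ⊆Λ χ∈Γ = inj₁ (Γ⊆Λ χ∈Γ)

  module Derivations (S : System) where

    infix 2 ⊢_ _⊢_ _⊩_

    ⊢_ : Form → Set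
    ⊢ A = Derivable S [] [ A ]

    _⊢_ : Form → Form → Set
    A ⊢ B = Derivable S [ A ] [ B ]

    private
      variable
        A B C G φ ψ X : Form
        Γ Δ Λ Σ : List Form

    cut₁ : Derivable S Γ [ A ] → Derivable S (Λ ++ [ A ]) Σ → Derivable S (Γ ++ Λ) Σ
    cut₁ = cut {Δ = []}

    exchangeˡ : Derivable S (A ∷ B ∷ []) Δ → Derivable S (B ∷ A ∷ []) Δ
    exchangeˡ = struct (⊆⇒⊆∪ (⊆-reflexive-↭ (↭-swap _ _ ↭-refl))) (⊆⇒⊆∪ ⊆-refl)

    exchangeʳ : Derivable S Γ (A ∷ B ∷ []) → Derivable S Γ (B ∷ A ∷ [])
    exchangeʳ = struct (⊆⇒⊆∪ ⊆-refl) (⊆⇒⊆∪ (⊆-reflexive-↭ (↭-swap _ _ ↭-refl)))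

    contractionʳ : Derivable S Γ (A ∷ A ∷ []) → Derivable S Γ [ A ]
    contractionʳ = struct (⊆⇒⊆∪ ⊆-refl) (⊆⇒⊆∪ (∈-∷⁺ʳ (here refl) ⊆-refl))

    modus-ponens : ⊢ A ⇒ B → ⊢ A → ⊢ B
    modus-ponens ⊢A⇒B ⊢A = cut₁ ⊢A⇒B (cut₁ ⊢A (exchangeˡ mp))

    sequent : ⊢ A ⇒ B → A ⊢ B
    sequent ⊢A⇒B = cut₁ ⊢A⇒B mp

    infixr 4 _⨾_
    _⨾_ : A ⊢ B → B ⊢ C → A ⊢ C
    d ⨾ e = cut₁ {Λ = []} d e

    case-split : ⊢ φ ⇒ A → ¬' φ ⊢ G → cond A φ ⊢ G → ⊢ G
    case-split {φ} {A} {G} ⊢φ⇒A ¬φ⊢G cond⊢G =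
      contractionʳ (cut {Δ = [ G ]} {Λ = []}
        (exchangeʳ (cut {Δ = [ ¬' φ ]} {Λ = []} (cut₁ ⊢φ⇒A b1) cond⊢G))
        ¬φ⊢G)

    data _⊩_ (Γ : List Form) : Form → Set where
      hyp : A ∈ Γ → Γ ⊩ A
      thm : ⊢ A → Γ ⊩ A
      app : Γ ⊩ A ⇒ B → Γ ⊩ A → Γ ⊩ B

    assumption : A ∷ Γ ⊩ A
    assumption = hyp (here refl)

    weaken : Γ ⊩ A → B ∷ Γ ⊩ A
    weaken (hyp A∈Γ) = hyp (there A∈Γ)
    weaken (thm ⊢A)  = thm ⊢A
    weaken (app d e) = app (weaken d) (weaken e)

    identity : Γ ⊩ A ⇒ A
    identity {A = A} = app (app (thm (c2 {φ = A ⇒ A})) (thm c1)) (thm c1)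

    deduction : A ∷ Γ ⊩ B → Γ ⊩ A ⇒ B
    deduction (hyp (here refl)) = identity
    deduction (hyp (there B∈Γ)) = app (thm c1) (hyp B∈Γ)
    deduction (thm ⊢B)          = app (thm c1) (thm ⊢B)
    deduction (app d e)         = app (app (thm c2) (deduction d)) (deduction e)

    discharge : [] ⊩ A → ⊢ A
    discharge (thm ⊢A)  = ⊢A
    discharge (app d e) = modus-ponens (discharge d) (discharge e)

    from-hypothesis : [ A ] ⊩ B → A ⊢ B
    from-hypothesis d = sequent (discharge (deduction d))

    by-contradiction : ¬' A ∷ Γ ⊩ B → ¬' A ∷ Γ ⊩ ¬' B → Γ ⊩ A
    by-contradiction d e = app (app (thm c3) (deduction e)) (deduction d)

    ex-falso : Γ ⊩ A → Γ ⊩ ¬' A → Γ ⊩ B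
    ex-falso a ¬a = by-contradiction (weaken a) (weaken ¬a)

    ¬¬-elim : Γ ⊩ ¬' (¬' A) → Γ ⊩ A
    ¬¬-elim d = by-contradiction assumption (weaken d)

    ¬-intro : A ∷ Γ ⊩ B → A ∷ Γ ⊩ ¬' B → Γ ⊩ ¬' A
    ¬-intro d e = by-contradiction
      (app (weaken (deduction d)) (¬¬-elim assumption))
      (app (weaken (deduction e)) (¬¬-elim assumption))

    ¬¬-intro : Γ ⊩ A → Γ ⊩ ¬' (¬' A)
    ¬¬-intro a = ¬-intro (weaken a) assumption

    ∧-intro : Γ ⊩ A → Γ ⊩ B → Γ ⊩ A ∧' B
    ∧-intro a b = ¬-intro (weaken b) (app assumption (¬¬-intro (weaken a)))

    ∧-elimˡ : Γ ⊩ A ∧' B → Γ ⊩ A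
    ∧-elimˡ d = by-contradiction
      (deduction (ex-falso (¬¬-elim assumption) (weaken assumption)))
      (weaken d)

    ∧-elimʳ : Γ ⊩ A ∧' B → Γ ⊩ B
    ∧-elimʳ d = by-contradiction (app (thm c1) assumption) (weaken d)

    ⇔-intro : A ∷ Γ ⊩ B → B ∷ Γ ⊩ A → Γ ⊩ A ⇔ B
    ⇔-intro d e = ∧-intro (deduction d) (deduction e)

    ⇔-to : Γ ⊩ A ⇔ B → Γ ⊩ A → Γ ⊩ B
    ⇔-to d = app (∧-elimˡ d)

    ⇔-from : Γ ⊩ A ⇔ B → Γ ⊩ B → Γ ⊩ A
    ⇔-from d = app (∧-elimʳ d)

    cond-mp : Γ ⊩ cond ψ φ → Γ ⊩ φ → Γ ⊩ ψ
    cond-mp d e = app (app (thm b3) d) e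

    cond-app : Γ ⊩ cond (A ⇒ B) φ → Γ ⊩ cond A φ → Γ ⊩ cond B φ
    cond-app d e = app (app (thm b2) d) e

    true-antecedent-×' : ⊢ φ ⇒ X ×' φ
    true-antecedent-×' = discharge (deduction (⇔-intro
      (cond-mp assumption (weaken assumption))
      (⇔-to (thm b4) (¬-intro (weaken assumption)
        (cond-mp assumption (weaken (weaken assumption)))))))

    ¬-×'-to-×' : (¬' φ) ×' X ⊢ φ ×' X
    ¬-×'-to-×' = from-hypothesis (⇔-intro
      (by-contradiction
        (⇔-from (weaken (weaken assumption)) assumption)
        (⇔-from (thm b4) (weaken assumption)))
      (⇔-to (thm b4) (¬-intro assumption
        (ex-falso (weaken assumption) (⇔-to (weaken (weaken assumption)) assumption)))))

  false-antecedent-×' : ∀ S {X φ} → Derivable S [ ¬' φ ] [ X ×' φ ]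
  false-antecedent-×' DBL  = sequent true-antecedent-×' ⨾ b5 refl ⨾ ¬-×'-to-×' ⨾ b5 refl
    where open Derivations DBL
  false-antecedent-×' DBL* = sequent true-antecedent-×' ⨾ b5wA₁ refl
    where open Derivations DBL*

  module Conditionals (S : System) where
    open Derivations S

    private
      variable
        A B T φ ψ : Form
        Γ : List Form

    necessitation : ⊢ T → ⊢ cond T φ
    necessitation ⊢T = case-split (discharge (app (thm c1) (thm ⊢T)))
      (false-antecedent-×' S ⨾ from-hypothesis (⇔-from assumption (thm ⊢T)))
      (from-hypothesis assumption)

    cond-mono : ⊢ A ⇒ B → Γ ⊩ cond A φ → Γ ⊩ cond B φ
    cond-mono ⊢A⇒B = cond-app (thm (necessitation ⊢A⇒B))

    cond-resp-⇔ : Γ ⊩ cond (A ⇔ B) φ → Γ ⊩ cond A φ ⇔ cond B φ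
    cond-resp-⇔ d = ⇔-intro
      (cond-app (cond-mono ⇔-forward (weaken d)) assumption)
      (cond-app (cond-mono ⇔-backward (weaken d)) assumption)
      where
        ⇔-forward : ⊢ (A ⇔ B) ⇒ (A ⇒ B)
        ⇔-forward = discharge (deduction (∧-elimˡ assumption))
        ⇔-backward : ⊢ (A ⇔ B) ⇒ (B ⇒ A)
        ⇔-backward = discharge (deduction (∧-elimʳ assumption))

    cond-×'-antecedent : ⊢ cond ψ φ ×' φ
    cond-×'-antecedent = case-split true-antecedent-×' (false-antecedent-×' S)
      (from-hypothesis (cond-resp-⇔ assumption))

mainTheorem5 : (n : ℕ) → (S : Language.System n) → (φ ψ : Language.Form n) →
    Language.Derivable n S [] [ Language._×'_ n (Language.Form.cond ψ φ) φ ]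
mainTheorem5 n S φ ψ = Conditionals.cond-×'-antecedent S
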